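{- Let $G$ be a finite connected simple cubic graph and let $e$ be an edge of $G$ whose orbit $O(e)$ under $\mathrm{Aut}\,G$ has minimal size among all orbits of edges of $G$. Then one of the following holds: \begin{itemize} \item $O(e)$ is all of $G$ (i.e. $G$ is edge-transitive); \item $O(e)$ is a disjoint union of stars; \item $O(e)$ is a disjoint union of edges; \item $O(e)$ is a disjoint union of cycles, any two of which are at distance at least two from each other. \end{itemize}
   Context: $O(e)$ is regarded as the subgraph of $G$ consisting of all edges in the orbit of $e$ together with their endpoints. A star means the star $K_{1,3}$ on four vertices. -}

module Defs where

open import Data.Nat using (ℕ; zero; suc; _≤_; _%_)
open import Data.Fin using (Fin; toℕ; _<_)
open import Data.Fin.Permutation using (Permutation′; _⟨$⟩ʳ_)
open import Data.Bool using (Bool; true; false)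
open import Data.List using (List; length; filterᵇ; allFin)
open import Data.List.Relation.Unary.Unique.Propositional using (Unique)
open import Data.List.Membership.Propositional using (_∈_)
open import Data.Product using (Σ; ∃; ∃-syntax; _×_; _,_)
open import Data.Sum using (_⊎_)
open import Relation.Binary.PropositionalEquality using (_≡_; _≢_)
open import Relation.Binary.Construct.Closure.ReflexiveTransitive using (Star)
open import Function.Bundles using (_⇔_)

record SimpleGraph (n : ℕ) : Set where
  field
    adj   : Fin n → Fin n → Bool
    sym   : ∀ x y → adj x y ≡ adj y x
    irrfl : ∀ x → adj x x ≡ false
open SimpleGraph public

module _ {n : ℕ} (G : SimpleGraph n) where

  Adj : Fin n → Fin n → Set
  Adj x y = adj G x y ≡ true

  degree : Fin n → ℕ
  degree x = length (filterᵇ (adj G x) (allFin n))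

  Cubic : Set
  Cubic = ∀ x → degree x ≡ 3

  Connected : Set
  Connected = ∀ x y → Star Adj x y

  IsAut : Permutation′ n → Set
  IsAut σ = ∀ x y → adj G (σ ⟨$⟩ʳ x) (σ ⟨$⟩ʳ y) ≡ adj G x y

  -- This is also the adjacency relation of the
  -- subgraph O(uv) (orbit edges together with their endpoints).
  InOrb : Fin n → Fin n → Fin n → Fin n → Set
  InOrb u v x y = ∃[ σ ] (IsAut σ ×
    ((σ ⟨$⟩ʳ u ≡ x × σ ⟨$⟩ʳ v ≡ y) ⊎ (σ ⟨$⟩ʳ u ≡ y × σ ⟨$⟩ʳ v ≡ x)))

  OrbitSize : Fin n → Fin n → ℕ → Set
  OrbitSize u v k = Σ (List (Fin n × Fin n)) λ L →
    Unique L × length L ≡ k ×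
    (∀ x y → ((x , y) ∈ L) ⇔ (x < y × InOrb u v x y))

-- Vertices of a graph given by an adjacency relation H: non-isolated ones
-- (for O(e): the endpoints of orbit edges).
InV : {n : ℕ} → (Fin n → Fin n → Set) → Fin n → Set
InV H x = ∃[ y ] H x y

ComponentIso : {n : ℕ} → (Fin n → Fin n → Set) → Fin n →
               (m : ℕ) → (Fin m → Fin m → Set) → Set
ComponentIso {n} H v m K = Σ (Fin m → Fin n) λ f →
  (∀ i j → f i ≡ f j → i ≡ j) ×
  (∀ i → Star H v (f i)) ×
  (∀ w → Star H v w → ∃[ i ] f i ≡ w) ×
  (∀ i j → H (f i) (f j) ⇔ K i j)

StarK13 : Fin 4 → Fin 4 → Set
StarK13 i j = (toℕ i ≡ 0 × toℕ j ≢ 0) ⊎ (toℕ j ≡ 0 × toℕ i ≢ 0)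

EdgeK2 : Fin 2 → Fin 2 → Set
EdgeK2 i j = i ≢ j

CycleC : (m : ℕ) → Fin m → Fin m → Set
CycleC zero i j = i ≡ j
CycleC (suc m) i j = toℕ j ≡ suc (toℕ i) % suc m ⊎ toℕ i ≡ suc (toℕ j) % suc m

DisjointUnionOf : {n : ℕ} → (Fin n → Fin n → Set) → (m : ℕ) → (Fin m → Fin m → Set) → Set
DisjointUnionOf H m K = ∀ v → InV H v → ComponentIso H v m K

DisjointUnionOfCycles : {n : ℕ} → (Fin n → Fin n → Set) → Set
DisjointUnionOfCycles H = ∀ v → InV H v → ∃[ m ] (3 ≤ m × ComponentIso H v m (CycleC m))

module _ {n : ℕ} (G : SimpleGraph n) where

  MinimalOrbit : Fin n → Fin n → Set
  MinimalOrbit u v = ∀ x y → Adj G x y → ∀ k l →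
    OrbitSize G u v k → OrbitSize G x y l → k ≤ l

  EdgeTransitiveOrb : Fin n → Fin n → Set
  EdgeTransitiveOrb u v = ∀ x y → Adj G x y → InOrb G u v x y

  -- distinct components of H are at distance ≥ 2 in G: no edge of G joins
  -- vertices of H lying in different components of H.
  ComponentsFar : (Fin n → Fin n → Set) → Set
  ComponentsFar H = ∀ x y → InV H x → InV H y → Adj G x y → Star H x y

module Submission where

-- Let d(x) be the number of edges of O = O(uv) at x.  Automorphisms preserve d, so every edge
-- of O joins a vertex of degree d(u) to one of degree d(v), and 1 ≤ d ≤ 3 as G is cubic.  The
-- pairs (1,1), (1,3) and (2,2) make O a disjoint union of edges, stars and cycles; for (3,3), O
-- is closed under adjacency and so, G being connected, all of G.  Minimality excludes the other
-- pairs and any edge of G between two cycles.  Let T = {x | d(x) = 2} and let wz be an edge of G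
-- outside O with w ∈ T.  A vertex of T lies on at most one edge of O(wz), since it already has
-- two edges of O.  All edges of an orbit have the same number of endpoints in T, say c for O and
-- c′ for O(wz), and counting incidences between orbit edges and T gives
--   c′ |O(wz)| ≤ |T| < 2 |T| = c |O|,
-- so |O(wz)| < |O| as soon as 1 ≤ c ≤ c′.  This holds when exactly one of u, v is in T (c = 1),
-- and when u, v, w, z are all in T (c = c′ = 2).

open import Data.Bool using (true; T?)
import Data.Bool.Properties as Bool
open import Data.Empty using (⊥-elim)
open import Data.Fin using (Fin; zero; suc; _≟_; punchIn; punchOut)
import Data.Fin as F
open import Data.Fin.Patterns using (0F; 1F; 2F; 3F)
open import Data.Fin.Permutation as Perm
  using (Permutation′; _⟨$⟩ʳ_; _⟨$⟩ˡ_; _≈_; insert; remove; insert-remove)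
import Data.Fin.Properties as F
open import Data.List using (List; []; _∷_; length; filter; tabulate; allFin; cartesianProduct; cartesianProductWith)
open import Data.List.Membership.Propositional using (_∈_; _∉_; lose)
open import Data.List.Membership.Propositional.Properties
  using (∈-allFin; ∈-filter⁺; ∈-filter⁻; ∈-cartesianProduct⁺; ∈-cartesianProductWith⁺)
open import Data.List.Relation.Unary.All using ([]; _∷_)
open import Data.List.Relation.Unary.Any using (Any; here; there; any?; satisfied)
open import Data.List.Relation.Unary.Unique.Propositional using (Unique; []; _∷_)
open import Data.List.Relation.Unary.Unique.Propositional.Properties
  using (Unique[x∷xs]⇒x∉xs; filter⁺; allFin⁺; cartesianProduct⁺)
open import Data.Nat using (ℕ; zero; suc; _+_; _*_; _≤_; _<_; z≤n; s≤s; _≤?_; _%_)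
import Data.Nat as ℕ
open import Data.Nat.DivMod using (m<n⇒m%n≡m; n%n≡0; m%n<n)
open import Data.Nat.Properties hiding (_≟_; suc-injective)
open import Data.Product using (_×_; _,_; proj₁; proj₂; uncurry; ∃-syntax; ∃₂)
import Data.Product as Product
open import Data.Product.Properties using (≡-dec; ,-injective)
open import Data.Sum using (_⊎_; inj₁; inj₂; [_,_]′; swap)
import Data.Sum as Sum
open import Function using (_∘_; _⇔_; mk⇔; Equivalence; case_of_)
open import Relation.Binary using (DecidableEquality; tri<; tri≈; tri>)
open import Relation.Binary.Construct.Closure.ReflexiveTransitive using (Star; ε; _◅_; _◅◅_)
open import Relation.Binary.PropositionalEquality
open import Relation.Nullary using (Dec; yes; no; ¬_; ¬?; _×-dec_; _⊎-dec_)
open import Relation.Nullary.Decidable using (map′)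

open import Defs hiding (sym)

open import Algebra.Properties.Semiring.Sum +-*-semiring
  using (sum-syntax; ∑-comm; ∑-distrib-+; *-distribˡ-sum; sum-cong-≗; sum-replicate-zero; ∑-permute)

-- Indicators and sums over Fin n

𝟙 : ∀ {a} {A : Set a} → Dec A → ℕ
𝟙 (yes _) = 1
𝟙 (no _)  = 0

module _ {a} {A : Set a} where

  𝟙-yes : A → (d : Dec A) → 𝟙 d ≡ 1
  𝟙-yes a (yes _) = refl
  𝟙-yes a (no ¬a) = ⊥-elim (¬a a)

  𝟙-no : ¬ A → (d : Dec A) → 𝟙 d ≡ 0
  𝟙-no ¬a (yes a) = ⊥-elim (¬a a)
  𝟙-no ¬a (no _)  = refl

𝟙-mono : ∀ {a b} {A : Set a} {B : Set b} → (A → B) → (d : Dec A) (e : Dec B) → 𝟙 d ≤ 𝟙 e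
𝟙-mono f (yes a) e = ≤-reflexive (sym (𝟙-yes (f a) e))
𝟙-mono f (no _)  e = z≤n

𝟙-cong : ∀ {a b} {A : Set a} {B : Set b} → A ⇔ B → (d : Dec A) (e : Dec B) → 𝟙 d ≡ 𝟙 e
𝟙-cong A⇔B d e = ≤-antisym (𝟙-mono to d e) (𝟙-mono from e d)
  where open Equivalence A⇔B

𝟙-× : ∀ {a b} {A : Set a} {B : Set b} (d : Dec A) (e : Dec B) → 𝟙 (d ×-dec e) ≡ 𝟙 d * 𝟙 e
𝟙-× (yes _) (yes _) = refl
𝟙-× (yes _) (no _)  = refl
𝟙-× (no _)  _       = refl

𝟙-⊎ : ∀ {a b} {A : Set a} {B : Set b} → ¬ (A × B) → (d : Dec A) (e : Dec B) → 𝟙 (d ⊎-dec e) ≡ 𝟙 d + 𝟙 e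
𝟙-⊎ ¬A×B (yes a) (yes b) = ⊥-elim (¬A×B (a , b))
𝟙-⊎ ¬A×B (yes _) (no _)  = refl
𝟙-⊎ ¬A×B (no _)  (yes _) = refl
𝟙-⊎ ¬A×B (no _)  (no _)  = refl

𝟙-+-≤ : ∀ {a b c} {A : Set a} {B : Set b} {C : Set c} → ¬ (A × B) → (A → C) → (B → C) →
        (d : Dec A) (e : Dec B) (f : Dec C) → 𝟙 d + 𝟙 e ≤ 𝟙 f
𝟙-+-≤ ¬A×B A→C B→C (yes a) (yes b) f = ⊥-elim (¬A×B (a , b))
𝟙-+-≤ ¬A×B A→C B→C (yes a) (no _)  f = ≤-reflexive (sym (𝟙-yes (A→C a) f))
𝟙-+-≤ ¬A×B A→C B→C (no _)  e       f = 𝟙-mono B→C e f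

module _ {n : ℕ} where

  ∑-zero : {f : Fin n → ℕ} → (∀ i → f i ≡ 0) → ∑[ i < n ] f i ≡ 0
  ∑-zero f≡0 = trans (sum-cong-≗ f≡0) (sum-replicate-zero n)

  ∑∑-distrib-+ : (f g : Fin n → Fin n → ℕ) →
    ∑[ x < n ] ∑[ y < n ] (f x y + g x y) ≡ (∑[ x < n ] ∑[ y < n ] f x y) + (∑[ x < n ] ∑[ y < n ] g x y)
  ∑∑-distrib-+ f g = trans (sum-cong-≗ {n} λ x → ∑-distrib-+ {n} (f x) (g x)) (∑-distrib-+ {n} _ _)

∑-mono-≤ : ∀ {n} {f g : Fin n → ℕ} → (∀ i → f i ≤ g i) → ∑[ i < n ] f i ≤ ∑[ i < n ] g i
∑-mono-≤ {zero}  f≤g = z≤n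
∑-mono-≤ {suc n} f≤g = +-mono-≤ (f≤g zero) (∑-mono-≤ (f≤g ∘ suc))

∑-mono-< : ∀ {n} {f g : Fin n → ℕ} → (∀ i → f i ≤ g i) → ∀ j → f j < g j →
           ∑[ i < n ] f i < ∑[ i < n ] g i
∑-mono-< f≤g zero    fj<gj = +-mono-<-≤ fj<gj (∑-mono-≤ (f≤g ∘ suc))
∑-mono-< f≤g (suc j) fj<gj = +-mono-≤-< (f≤g zero) (∑-mono-< (f≤g ∘ suc) j fj<gj)

∑-𝟙-≟ : ∀ {n} (a : Fin n) → ∑[ x < n ] 𝟙 (x ≟ a) ≡ 1
∑-𝟙-≟ {suc n} zero    = cong suc (∑-zero {n} λ x → 𝟙-no (λ ()) (suc x ≟ zero))
∑-𝟙-≟ {suc n} (suc a) = begin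
  𝟙 (zero ≟ suc a) + ∑[ x < n ] 𝟙 (suc x ≟ suc a) ≡⟨ cong₂ _+_ (𝟙-no (λ ()) (zero ≟ suc a))
                                                               (sum-cong-≗ {n} λ x → 𝟙-cong suc≡suc⇔≡ _ _) ⟩
  ∑[ x < n ] 𝟙 (x ≟ a)                             ≡⟨ ∑-𝟙-≟ a ⟩
  1                                                ∎
  where
  open ≡-Reasoning
  suc≡suc⇔≡ : ∀ {x : Fin n} → (suc x ≡ suc a) ⇔ (x ≡ a)
  suc≡suc⇔≡ = mk⇔ F.suc-injective (cong suc)

∑-𝟙-pos : ∀ {p n} {P : Fin n → Set p} (P? : ∀ i → Dec (P i)) {j} → P j → 1 ≤ ∑[ i < n ] 𝟙 (P? i)
∑-𝟙-pos {n = n} P? {j} pj = begin-strict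
  0                   ≡⟨ ∑-zero {n} (λ _ → refl) ⟨
  ∑[ i < n ] 0        <⟨ ∑-mono-< (λ _ → z≤n) j (≤-reflexive (sym (𝟙-yes pj (P? j)))) ⟩
  ∑[ i < n ] 𝟙 (P? i) ∎
  where open ≤-Reasoning

module _ {p q n} {P : Fin n → Set p} {Q : Fin n → Set q} (P? : ∀ i → Dec (P i)) (Q? : ∀ i → Dec (Q i)) where

  ∑-𝟙-saturated : (∀ {i} → P i → Q i) → ∑[ i < n ] 𝟙 (Q? i) ≤ ∑[ i < n ] 𝟙 (P? i) → ∀ {j} → Q j → P j
  ∑-𝟙-saturated P⇒Q ∑Q≤∑P {j} qj with P? j
  ... | yes pj = pj
  ... | no ¬pj = ⊥-elim (<⇒≱ (∑-mono-< (λ i → 𝟙-mono P⇒Q (P? i) (Q? i)) j pj<qj) ∑Q≤∑P)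
    where
    pj<qj : 𝟙 (P? j) < 𝟙 (Q? j)
    pj<qj = subst₂ _<_ (sym (𝟙-no ¬pj (P? j))) (sym (𝟙-yes qj (Q? j))) ≤-refl

  ∑-𝟙-unsaturated : ∑[ i < n ] 𝟙 (P? i) < ∑[ i < n ] 𝟙 (Q? i) → ∃[ j ] (Q j × ¬ P j)
  ∑-𝟙-unsaturated ∑P<∑Q with F.any? (λ j → Q? j ×-dec ¬? (P? j))
  ... | yes witness = witness
  ... | no none     = ⊥-elim (<⇒≱ ∑P<∑Q (∑-mono-≤ λ i → q≤p i (Q? i) (P? i)))
    where
    q≤p : ∀ i (d : Dec (Q i)) (e : Dec (P i)) → 𝟙 d ≤ 𝟙 e
    q≤p i (yes qi) (no ¬pi) = ⊥-elim (none (i , qi , ¬pi))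
    q≤p i (yes _)  (yes _)  = ≤-refl
    q≤p i (no _)   _        = z≤n

length-filter-tabulate : ∀ {a p} {A : Set a} {P : A → Set p} (P? : ∀ x → Dec (P x)) {n} (f : Fin n → A) →
  length (filter P? (tabulate f)) ≡ ∑[ i < n ] 𝟙 (P? (f i))
length-filter-tabulate P? {zero}  f = refl
length-filter-tabulate P? {suc n} f with P? (f zero)
... | yes _ = cong suc (length-filter-tabulate P? (f ∘ suc))
... | no _  = length-filter-tabulate P? (f ∘ suc)

module _ {n : ℕ} where

  _≟²_ : DecidableEquality (Fin n × Fin n)
  _≟²_ = ≡-dec _≟_ _≟_

  open import Data.List.Membership.DecPropositional _≟²_ using (_∈?_)

  ∑∑-𝟙-≟² : (b : Fin n × Fin n) → ∑[ x < n ] ∑[ y < n ] 𝟙 ((x , y) ≟² b) ≡ 1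
  ∑∑-𝟙-≟² (b₁ , b₂) = begin
    ∑[ x < n ] ∑[ y < n ] 𝟙 ((x , y) ≟² (b₁ , b₂))
      ≡⟨ sum-cong-≗ {n} (λ x → sum-cong-≗ {n} λ y → trans (𝟙-cong pair≡⇔ _ _) (𝟙-× (x ≟ b₁) (y ≟ b₂))) ⟩
    ∑[ x < n ] ∑[ y < n ] (𝟙 (x ≟ b₁) * 𝟙 (y ≟ b₂))
      ≡⟨ sum-cong-≗ {n} (λ x → *-distribˡ-sum {n} (𝟙 (x ≟ b₁)) _) ⟨
    ∑[ x < n ] (𝟙 (x ≟ b₁) * ∑[ y < n ] 𝟙 (y ≟ b₂))
      ≡⟨ sum-cong-≗ {n} (λ x → trans (cong (𝟙 (x ≟ b₁) *_) (∑-𝟙-≟ b₂)) (*-identityʳ _)) ⟩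
    ∑[ x < n ] 𝟙 (x ≟ b₁)
      ≡⟨ ∑-𝟙-≟ b₁ ⟩
    1 ∎
    where
    open ≡-Reasoning
    pair≡⇔ : ∀ {x y} → ((x , y) ≡ (b₁ , b₂)) ⇔ (x ≡ b₁ × y ≡ b₂)
    pair≡⇔ = mk⇔ ,-injective (uncurry (cong₂ _,_))

  Unique⇒length≡∑∑𝟙∈ : (L : List (Fin n × Fin n)) → Unique L →
                       length L ≡ ∑[ x < n ] ∑[ y < n ] 𝟙 ((x , y) ∈? L)
  Unique⇒length≡∑∑𝟙∈ []      []          =
    sym (∑-zero {n} λ x → ∑-zero {n} λ y → 𝟙-no (λ ()) ((x , y) ∈? []))
  Unique⇒length≡∑∑𝟙∈ (b ∷ L) (b∉ ∷ uniq) = begin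
    suc (length L)
      ≡⟨ cong₂ _+_ (∑∑-𝟙-≟² b) (sym (Unique⇒length≡∑∑𝟙∈ L uniq)) ⟨
    (∑[ x < n ] ∑[ y < n ] 𝟙 ((x , y) ≟² b)) + (∑[ x < n ] ∑[ y < n ] 𝟙 ((x , y) ∈? L))
      ≡⟨ ∑∑-distrib-+ (λ x y → 𝟙 ((x , y) ≟² b)) (λ x y → 𝟙 ((x , y) ∈? L)) ⟨
    ∑[ x < n ] ∑[ y < n ] (𝟙 ((x , y) ≟² b) + 𝟙 ((x , y) ∈? L))
      ≡⟨ sum-cong-≗ {n} (λ x → sum-cong-≗ {n} λ y → 𝟙-∈-∷ (x , y) (_ ≟² b) (_ ∈? L)) ⟨
    ∑[ x < n ] ∑[ y < n ] 𝟙 ((x , y) ∈? b ∷ L)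
      ∎
    where
    open ≡-Reasoning
    b∉L : b ∉ L
    b∉L = Unique[x∷xs]⇒x∉xs (b∉ ∷ uniq)
    𝟙-∈-∷ : ∀ p (d : Dec (p ≡ b)) (e : Dec (p ∈ L)) → 𝟙 (p ∈? b ∷ L) ≡ 𝟙 d + 𝟙 e
    𝟙-∈-∷ p (yes refl) e        = trans (𝟙-yes (here refl) (p ∈? b ∷ L)) (cong suc (sym (𝟙-no b∉L e)))
    𝟙-∈-∷ p (no p≢b)   (yes p∈) = 𝟙-yes (there p∈) (p ∈? b ∷ L)
    𝟙-∈-∷ p (no p≢b)   (no p∉)  = 𝟙-no (λ { (here e) → p≢b e ; (there p∈) → p∉ p∈ }) (p ∈? b ∷ L)

least : ∀ {p} {P : ℕ → Set p} → (∀ k → Dec (P k)) → ∀ {k} → P k → ∃[ m ] (P m × ∀ {j} → j < m → ¬ P j)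
least {P = P} P? {k} pk = below k (k , ≤-refl , pk)
  where
  below : ∀ k → ∃[ j ] (j ≤ k × P j) → ∃[ m ] (P m × ∀ {j} → j < m → ¬ P j)
  below zero    (zero , _ , p0) = zero , p0 , λ ()
  below (suc k) (j , j≤1+k , pj) with F.any? {n = suc k} (P? ∘ F.toℕ)
  ... | yes (i , pi) = below k (F.toℕ i , F.toℕ≤pred[n] i , pi)
  ... | no none with m≤n⇒m<n∨m≡n j≤1+k
  ...   | inj₁ j<1+k = ⊥-elim (none (F.fromℕ< j<1+k , subst P (sym (F.toℕ-fromℕ< j<1+k)) pj))
  ...   | inj₂ refl  = suc k , pj , λ i<1+k pi → none (F.fromℕ< i<1+k , subst P (sym (F.toℕ-fromℕ< i<1+k)) pi)

-- Enumerating the permutations of Fin n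

insert-cong : ∀ {m} (i j : Fin (suc m)) {π ρ : Permutation′ m} → π ≈ ρ → insert i j π ≈ insert i j ρ
insert-cong i j π≈ρ k with i ≟ k
... | yes _  = refl
... | no i≢k = cong (punchIn j) (π≈ρ (punchOut i≢k))

allPermutations : (n : ℕ) → List (Permutation′ n)
allPermutations zero    = Perm.id ∷ []
allPermutations (suc n) = cartesianProductWith (insert zero) (allFin (suc n)) (allPermutations n)

∈-allPermutations : ∀ n (σ : Permutation′ n) → ∃[ τ ] (τ ∈ allPermutations n × τ ≈ σ)
∈-allPermutations zero    σ = Perm.id , here refl , λ ()
∈-allPermutations (suc n) σ with ∈-allPermutations n (remove zero σ)
... | τ , τ∈ , τ≈σ₀ = insert zero (σ ⟨$⟩ʳ zero) τ
                    , ∈-cartesianProductWith⁺ (insert zero) (∈-allFin (σ ⟨$⟩ʳ zero)) τ∈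
                    , λ k → trans (insert-cong zero (σ ⟨$⟩ʳ zero) τ≈σ₀ k) (insert-remove zero σ k)

-- Symmetric irreflexive decidable relations on Fin n

module SimpleRelation {n : ℕ} (R : Fin n → Fin n → Set) (R? : ∀ x y → Dec (R x y))
  (R-sym : ∀ {x y} → R x y → R y x) (R-irr : ∀ {x} → ¬ R x x) where

  neighbours : Fin n → List (Fin n)
  neighbours x = filter (R? x) (allFin n)

  deg : Fin n → ℕ
  deg x = length (neighbours x)

  deg≡∑ : ∀ x → deg x ≡ ∑[ y < n ] 𝟙 (R? x y)
  deg≡∑ x = length-filter-tabulate (R? x) (λ y → y)

  Edge : Fin n → Fin n → Set
  Edge x y = x F.< y × R x y

  Edge? : ∀ x y → Dec (Edge x y)
  Edge? x y = (x F.<? y) ×-dec R? x y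

  edgeCount : ℕ
  edgeCount = ∑[ x < n ] ∑[ y < n ] 𝟙 (Edge? x y)

  length≡edgeCount : (L : List (Fin n × Fin n)) → Unique L → (∀ x y → (x , y) ∈ L ⇔ Edge x y) →
                     length L ≡ edgeCount
  length≡edgeCount L uniq ∈L⇔Edge = trans (Unique⇒length≡∑∑𝟙∈ L uniq)
    (sum-cong-≗ {n} λ x → sum-cong-≗ {n} λ y → 𝟙-cong (∈L⇔Edge x y) _ _)

  R⇔Edge⊎Edge : ∀ {x y} → R x y ⇔ (Edge x y ⊎ Edge y x)
  R⇔Edge⊎Edge {x} {y} = mk⇔ orient [ proj₂ , R-sym ∘ proj₂ ]′
    where
    orient : R x y → Edge x y ⊎ Edge y x
    orient r with F.<-cmp x y
    ... | tri< x<y _ _  = inj₁ (x<y , r)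
    ... | tri≈ _ refl _ = ⊥-elim (R-irr r)
    ... | tri> _ _ y<x  = inj₂ (y<x , R-sym r)

  𝟙-R : ∀ x y → 𝟙 (R? x y) ≡ 𝟙 (Edge? x y) + 𝟙 (Edge? y x)
  𝟙-R x y = trans (𝟙-cong R⇔Edge⊎Edge (R? x y) (Edge? x y ⊎-dec Edge? y x))
                  (𝟙-⊎ (λ (xy , yx) → F.<-asym (proj₁ xy) (proj₁ yx)) (Edge? x y) (Edge? y x))

  ∑-Edge-weights : (g : Fin n → ℕ) →
    ∑[ x < n ] ∑[ y < n ] (𝟙 (Edge? x y) * (g x + g y)) ≡ ∑[ x < n ] (g x * deg x)
  ∑-Edge-weights g = begin
    ∑[ x < n ] ∑[ y < n ] (e x y * (g x + g y))
      ≡⟨ sum-cong-≗ {n} (λ x → sum-cong-≗ {n} λ y → *-distribˡ-+ (e x y) (g x) (g y)) ⟩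
    ∑[ x < n ] ∑[ y < n ] (e x y * g x + e x y * g y)
      ≡⟨ ∑∑-distrib-+ (λ x y → e x y * g x) (λ x y → e x y * g y) ⟩
    (∑[ x < n ] ∑[ y < n ] (e x y * g x)) + (∑[ x < n ] ∑[ y < n ] (e x y * g y))
      ≡⟨ cong ((∑[ x < n ] ∑[ y < n ] (e x y * g x)) +_) (∑-comm {n} {n} λ x y → e x y * g y) ⟩
    (∑[ x < n ] ∑[ y < n ] (e x y * g x)) + (∑[ x < n ] ∑[ y < n ] (e y x * g x))
      ≡⟨ ∑∑-distrib-+ (λ x y → e x y * g x) (λ x y → e y x * g x) ⟨
    ∑[ x < n ] ∑[ y < n ] (e x y * g x + e y x * g x)
      ≡⟨ sum-cong-≗ {n} (λ x → sum-cong-≗ {n} λ y → *-distribʳ-+ (g x) (e x y) (e y x)) ⟨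
    ∑[ x < n ] ∑[ y < n ] ((e x y + e y x) * g x)
      ≡⟨ sum-cong-≗ {n} (λ x → sum-cong-≗ {n} λ y → trans (cong (_* g x) (sym (𝟙-R x y))) (*-comm _ (g x))) ⟩
    ∑[ x < n ] ∑[ y < n ] (g x * 𝟙 (R? x y))
      ≡⟨ sum-cong-≗ {n} (λ x → trans (sym (*-distribˡ-sum {n} (g x) _)) (cong (g x *_) (sym (deg≡∑ x)))) ⟩
    ∑[ x < n ] (g x * deg x)
      ∎
    where
    open ≡-Reasoning
    e : Fin n → Fin n → ℕ
    e x y = 𝟙 (Edge? x y)

  handshake : (g : Fin n → ℕ) (c : ℕ) → (∀ {x y} → R x y → g x + g y ≡ c) →
              c * edgeCount ≡ ∑[ x < n ] (g x * deg x)
  handshake g c edge-weight = begin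
    c * ∑[ x < n ] ∑[ y < n ] 𝟙 (Edge? x y)
      ≡⟨ *-distribˡ-sum {n} c _ ⟩
    ∑[ x < n ] (c * ∑[ y < n ] 𝟙 (Edge? x y))
      ≡⟨ sum-cong-≗ {n} (λ x → *-distribˡ-sum {n} c _) ⟩
    ∑[ x < n ] ∑[ y < n ] (c * 𝟙 (Edge? x y))
      ≡⟨ sum-cong-≗ {n} (λ x → sum-cong-≗ {n} λ y → weigh x y (Edge? x y)) ⟩
    ∑[ x < n ] ∑[ y < n ] (𝟙 (Edge? x y) * (g x + g y))
      ≡⟨ ∑-Edge-weights g ⟩
    ∑[ x < n ] (g x * deg x)
      ∎
    where
    open ≡-Reasoning
    weigh : ∀ x y (d : Dec (Edge x y)) → c * 𝟙 d ≡ 𝟙 d * (g x + g y)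
    weigh x y (yes (_ , r)) = trans (*-identityʳ c) (trans (sym (edge-weight r)) (sym (+-identityʳ _)))
    weigh x y (no _)        = *-zeroʳ c

  ∈-neighbours⁺ : ∀ {x y} → R x y → y ∈ neighbours x
  ∈-neighbours⁺ {x} {y} = ∈-filter⁺ (R? x) (∈-allFin y)

  ∈-neighbours⁻ : ∀ {x y} → y ∈ neighbours x → R x y
  ∈-neighbours⁻ {x} = proj₂ ∘ ∈-filter⁻ (R? x) {xs = allFin n}

  neighbours-unique : ∀ x → Unique (neighbours x)
  neighbours-unique x = filter⁺ (R? x) (allFin⁺ n)

  one-neighbour : ∀ {x} → deg x ≡ 1 → ∃[ a ] (R x a × ∀ {y} → R x y → y ≡ a)
  one-neighbour {x} d≡1 with neighbours x in eq | d≡1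
  ... | a ∷ [] | _ = a , ∈-neighbours⁻ (subst (a ∈_) (sym eq) (here refl))
                       , λ r → case subst (_ ∈_) eq (∈-neighbours⁺ r) of λ { (here e) → e }

  two-neighbours : ∀ {x} → deg x ≡ 2 →
    ∃₂ λ a b → a ≢ b × R x a × R x b × (∀ {y} → R x y → y ≡ a ⊎ y ≡ b)
  two-neighbours {x} d≡2 with neighbours x in eq | d≡2 | neighbours-unique x
  ... | a ∷ b ∷ [] | _ | (a≢b ∷ []) ∷ _ =
    a , b , a≢b , nbr (here refl) , nbr (there (here refl)) ,
    λ r → case subst (_ ∈_) eq (∈-neighbours⁺ r) of λ { (here e) → inj₁ e ; (there (here e)) → inj₂ e }
    where
    nbr : ∀ {y} → y ∈ a ∷ b ∷ [] → R x y
    nbr {y} = ∈-neighbours⁻ ∘ subst (y ∈_) (sym eq)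

  three-neighbours : ∀ {x} → deg x ≡ 3 →
    ∃₂ λ a b → ∃[ c ] ((a ≢ b × a ≢ c × b ≢ c) × (R x a × R x b × R x c) ×
                       (∀ {y} → R x y → y ≡ a ⊎ y ≡ b ⊎ y ≡ c))
  three-neighbours {x} d≡3 with neighbours x in eq | d≡3 | neighbours-unique x
  ... | a ∷ b ∷ c ∷ [] | _ | (a≢b ∷ a≢c ∷ []) ∷ (b≢c ∷ []) ∷ _ =
    a , b , c , (a≢b , a≢c , b≢c) , (nbr (here refl) , nbr (there (here refl)) , nbr (there (there (here refl)))) ,
    λ r → case subst (_ ∈_) eq (∈-neighbours⁺ r) of λ
      { (here e) → inj₁ e ; (there (here e)) → inj₂ (inj₁ e) ; (there (there (here e))) → inj₂ (inj₂ e) }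
    where
    nbr : ∀ {y} → y ∈ a ∷ b ∷ c ∷ [] → R x y
    nbr {y} = ∈-neighbours⁻ ∘ subst (y ∈_) (sym eq)

  ≢-of-R : ∀ {x y} → R x y → x ≢ y
  ≢-of-R r refl = R-irr r

  image-closed : ∀ {m} (f : Fin m → Fin n) → (∀ i {w} → R (f i) w → ∃[ j ] f j ≡ w) →
                 ∀ {v} → ∃[ i ] f i ≡ v → ∀ w → Star R v w → ∃[ j ] f j ≡ w
  image-closed f closed v∈f        _ ε        = v∈f
  image-closed f closed (i , refl) w (r ◅ rs) = image-closed f closed (closed i r) w rs

  edge-components : (∀ {x y} → R x y → deg x ≡ 1) → DisjointUnionOf R 2 EdgeK2
  edge-components deg≡1 v (_ , v~y) with one-neighbour (deg≡1 v~y)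
  ... | a , v~a , only-a = f , f-injective , reach , image-closed f closed (0F , refl) , iso
    where
    f : Fin 2 → Fin n
    f 0F = v
    f 1F = a
    f-injective : ∀ i j → f i ≡ f j → i ≡ j
    f-injective 0F 0F _ = refl
    f-injective 0F 1F e = ⊥-elim (≢-of-R v~a e)
    f-injective 1F 0F e = ⊥-elim (≢-of-R v~a (sym e))
    f-injective 1F 1F _ = refl
    reach : ∀ i → Star R v (f i)
    reach 0F = ε
    reach 1F = v~a ◅ ε
    closed : ∀ i {w} → R (f i) w → ∃[ j ] f j ≡ w
    closed 0F r = 1F , sym (only-a r)
    closed 1F r with one-neighbour (deg≡1 (R-sym v~a))
    ... | _ , _ , only-b = 0F , trans (only-b (R-sym v~a)) (sym (only-b r))
    iso : ∀ i j → R (f i) (f j) ⇔ EdgeK2 i j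
    iso 0F 0F = mk⇔ (⊥-elim ∘ R-irr) (λ i≢i → ⊥-elim (i≢i refl))
    iso 0F 1F = mk⇔ (λ _ ()) (λ _ → v~a)
    iso 1F 0F = mk⇔ (λ _ ()) (λ _ → R-sym v~a)
    iso 1F 1F = mk⇔ (⊥-elim ∘ R-irr) (λ i≢i → ⊥-elim (i≢i refl))

  star-component : ∀ {c} → deg c ≡ 3 → (∀ {w} → R c w → deg w ≡ 1) →
                   ∀ {v} → Star R v c → c ≡ v ⊎ R c v → ComponentIso R v 4 StarK13
  star-component {c} deg≡3 leaves-deg≡1 {v} v→c v∈star with three-neighbours deg≡3
  ... | a , b , d , (a≢b , a≢d , b≢d) , (c~a , c~b , c~d) , only-abd =
    f , f-injective , reach , image-closed f closed (index v∈star) , iso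
    where
    f : Fin 4 → Fin n
    f 0F = c
    f 1F = a
    f 2F = b
    f 3F = d
    c~leaf : ∀ k → R c (f (suc k))
    c~leaf 0F = c~a
    c~leaf 1F = c~b
    c~leaf 2F = c~d
    leaf~ : ∀ {w x} → R c w → R w x → x ≡ c
    leaf~ c~w w~x with one-neighbour (leaves-deg≡1 c~w)
    ... | _ , _ , only = trans (only w~x) (sym (only (R-sym c~w)))
    f-injective : ∀ i j → f i ≡ f j → i ≡ j
    f-injective 0F      0F      _ = refl
    f-injective 0F      (suc k) e = ⊥-elim (≢-of-R (c~leaf k) e)
    f-injective (suc k) 0F      e = ⊥-elim (≢-of-R (c~leaf k) (sym e))
    f-injective 1F 1F _ = refl
    f-injective 1F 2F e = ⊥-elim (a≢b e)
    f-injective 1F 3F e = ⊥-elim (a≢d e)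
    f-injective 2F 1F e = ⊥-elim (a≢b (sym e))
    f-injective 2F 2F _ = refl
    f-injective 2F 3F e = ⊥-elim (b≢d e)
    f-injective 3F 1F e = ⊥-elim (a≢d (sym e))
    f-injective 3F 2F e = ⊥-elim (b≢d (sym e))
    f-injective 3F 3F _ = refl
    reach : ∀ i → Star R v (f i)
    reach 0F      = v→c
    reach (suc k) = v→c ◅◅ (c~leaf k ◅ ε)
    index : ∀ {w} → c ≡ w ⊎ R c w → ∃[ i ] f i ≡ w
    index (inj₁ e) = 0F , e
    index (inj₂ c~w) with only-abd c~w
    ... | inj₁ e        = 1F , sym e
    ... | inj₂ (inj₁ e) = 2F , sym e
    ... | inj₂ (inj₂ e) = 3F , sym e
    closed : ∀ i {w} → R (f i) w → ∃[ j ] f j ≡ w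
    closed 0F      r = index (inj₂ r)
    closed (suc k) r = 0F , sym (leaf~ (c~leaf k) r)
    iso : ∀ i j → R (f i) (f j) ⇔ StarK13 i j
    iso 0F      0F      = mk⇔ (⊥-elim ∘ R-irr)
                              λ { (inj₁ (_ , 0≢0)) → ⊥-elim (0≢0 refl) ; (inj₂ (_ , 0≢0)) → ⊥-elim (0≢0 refl) }
    iso 0F      (suc k) = mk⇔ (λ _ → inj₁ (refl , λ ())) (λ _ → c~leaf k)
    iso (suc k) 0F      = mk⇔ (λ _ → inj₂ (refl , λ ())) (λ _ → R-sym (c~leaf k))
    iso (suc k) (suc l) = mk⇔ (λ r → ⊥-elim (R-irr (subst (R c) (leaf~ (c~leaf k) r) (c~leaf l))))
                              λ { (inj₁ (() , _)) ; (inj₂ (() , _)) }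

  star-components : (∀ {x y} → R x y → (deg x ≡ 3 × deg y ≡ 1) ⊎ (deg x ≡ 1 × deg y ≡ 3)) →
                    DisjointUnionOf R 4 StarK13
  star-components degrees v (y , v~y) = centred (degrees v~y)
    where
    leaf-deg : ∀ {c w} → deg c ≡ 3 → R c w → deg w ≡ 1
    leaf-deg deg-c≡3 c~w with degrees c~w
    ... | inj₁ (_ , deg-w≡1) = deg-w≡1
    ... | inj₂ (deg-c≡1 , _) = case trans (sym deg-c≡3) deg-c≡1 of λ ()
    centred : (deg v ≡ 3 × deg y ≡ 1) ⊎ (deg v ≡ 1 × deg y ≡ 3) → ComponentIso R v 4 StarK13
    centred (inj₁ (deg-v≡3 , _)) = star-component deg-v≡3 (leaf-deg deg-v≡3) ε (inj₁ refl)
    centred (inj₂ (_ , deg-y≡3)) = star-component deg-y≡3 (leaf-deg deg-y≡3) (v~y ◅ ε) (inj₂ (R-sym v~y))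

  module TwoRegular (deg≡2 : ∀ {x y} → R x y → deg x ≡ 2) where

    turn : ∀ {x y} → R x y → ∃[ z ] (R y z × z ≢ x × ∀ {t} → R y t → t ≡ x ⊎ t ≡ z)
    turn {x} x~y with two-neighbours (deg≡2 (R-sym x~y))
    ... | a , b , a≢b , y~a , y~b , only with x ≟ a
    ...   | yes refl = b , y~b , a≢b ∘ sym , only
    ...   | no x≢a with only (R-sym x~y)
    ...     | inj₁ x≡a  = ⊥-elim (x≢a x≡a)
    ...     | inj₂ refl = a , y~a , x≢a ∘ sym , swap ∘ only

    record Arc : Set where
      constructor arc
      field
        {source target} : Fin n
        edge            : R source target

    next : Arc → Arc
    next α = arc (proj₁ (proj₂ (turn (Arc.edge α))))

    module Walk {v a : Fin n} (v~a : R v a) where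

      arcs : ℕ → Arc
      arcs zero    = arc v~a
      arcs (suc k) = next (arcs k)

      w : ℕ → Fin n
      w k = Arc.source (arcs k)

      step : ∀ k → R (w k) (w (suc k))
      step k = Arc.edge (arcs k)

      no-backtrack : ∀ k → w (suc (suc k)) ≢ w k
      no-backtrack k = proj₁ (proj₂ (proj₂ (turn (step k))))

      neighbours-of-w : ∀ k {t} → R (w (suc k)) t → t ≡ w k ⊎ t ≡ w (suc (suc k))
      neighbours-of-w k = proj₂ (proj₂ (proj₂ (turn (step k))))

      Returns : ℕ → Set
      Returns k = 1 ≤ k × w k ≡ v

      returns? : ∀ k → Dec (Returns k)
      returns? k = (1 ≤? k) ×-dec (w k ≟ v)

      -- A non-backtracking walk in a 2-regular graph can only revisit a vertex by first
      -- coming back to its starting point.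
      repeat⇒returns : ∀ {i j} → i < j → w i ≡ w j → ∃[ k ] (Returns k × k ≤ j)
      repeat⇒returns {zero}  {suc j} _ wi≡wj = suc j , (s≤s z≤n , sym wi≡wj) , ≤-refl
      repeat⇒returns {suc i} {suc j} (s≤s i<j) wi≡wj
        with neighbours-of-w i (subst (λ t → R t (w j)) (sym wi≡wj) (R-sym (step j)))
      ... | inj₁ wj≡wi = let k , ret , k≤j = repeat⇒returns i<j (sym wj≡wi) in k , ret , m≤n⇒m≤1+n k≤j
      ... | inj₂ wj≡wi+2 with <-cmp j (suc (suc i))
      ...   | tri> _ _ i+2<j = let k , ret , k≤j = repeat⇒returns i+2<j (sym wj≡wi+2) in k , ret , m≤n⇒m≤1+n k≤j
      ...   | tri≈ _ refl _  = ⊥-elim (no-backtrack (suc i) (sym wi≡wj))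
      ...   | tri< j<i+2 _ _ with ≤-antisym (≤-pred j<i+2) i<j
      ...     | refl = ⊥-elim (R-irr (subst (λ t → R t (w (suc (suc i)))) wi≡wj (step (suc i))))

      first-return : ∃[ m ] (Returns m × ∀ {j} → j < m → ¬ Returns j)
      first-return =
        let i , j , i<j , wi≡wj = F.pigeonhole (n<1+n n) (w ∘ F.toℕ)
            k , k-returns , _   = repeat⇒returns i<j wi≡wj
        in least returns? k-returns

      module FirstReturn {m : ℕ} (returns : w (suc m) ≡ v) (first : ∀ {j} → j < suc m → ¬ Returns j) where

        M : ℕ
        M = suc m

        w-injective : ∀ {i j} → i < M → j < M → w i ≡ w j → i ≡ j
        w-injective {i} {j} i<M j<M wi≡wj with <-cmp i j
        ... | tri< i<j _ _ = let k , ret , k≤j = repeat⇒returns i<j wi≡wj in ⊥-elim (first (≤-<-trans k≤j j<M) ret)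
        ... | tri≈ _ i≡j _ = i≡j
        ... | tri> _ _ j<i = let k , ret , k≤i = repeat⇒returns j<i (sym wi≡wj) in ⊥-elim (first (≤-<-trans k≤i i<M) ret)

        m≢0 : m ≢ 0
        m≢0 refl = R-irr (subst (λ t → R t a) (sym returns) v~a)

        m≢1 : m ≢ 1
        m≢1 refl = no-backtrack 0 returns

        3≤M : 3 ≤ M
        3≤M = at-least-3 m m≢0 m≢1
          where
          at-least-3 : ∀ k → k ≢ 0 → k ≢ 1 → 3 ≤ suc k
          at-least-3 zero          k≢0 _   = ⊥-elim (k≢0 refl)
          at-least-3 (suc zero)    _   k≢1 = ⊥-elim (k≢1 refl)
          at-least-3 (suc (suc _)) _   _   = s≤s (s≤s (s≤s z≤n))

        prev : ℕ → ℕ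
        prev zero    = m
        prev (suc i) = i

        prev<M : ∀ {i} → i < M → prev i < M
        prev<M {zero}  _   = ≤-refl
        prev<M {suc i} i<M = <-trans (n<1+n i) i<M

        suc-prev : ∀ {i} → i < M → suc (prev i) % M ≡ i
        suc-prev {zero}  _   = n%n≡0 M
        suc-prev {suc i} i<M = m<n⇒m%n≡m i<M

        w-suc% : ∀ {i} → i < M → w (suc i % M) ≡ w (suc i)
        w-suc% {i} i<M with m≤n⇒m<n∨m≡n i<M
        ... | inj₁ 1+i<M = cong w (m<n⇒m%n≡m 1+i<M)
        ... | inj₂ refl  = trans (cong w (n%n≡0 M)) (sym returns)

        neighbours-of-v : ∀ {t} → R v t → t ≡ w (1 % M) ⊎ t ≡ w m
        neighbours-of-v v~t with turn (R-sym v~a)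
        ... | z , _ , _ , only with only (R-sym (subst (R (w m)) returns (step m))) | only v~t
        ...   | inj₁ wm≡a | _        = ⊥-elim (m≢1 (w-injective (n<1+n m) (s≤s (n≢0⇒n>0 m≢0)) wm≡a))
        ...   | inj₂ wm≡z | inj₁ t≡a = inj₁ (trans t≡a (sym (w-suc% (s≤s z≤n))))
        ...   | inj₂ wm≡z | inj₂ t≡z = inj₂ (trans t≡z (sym wm≡z))

        neighbours-on-cycle : ∀ {i t} → i < M → R (w i) t → t ≡ w (suc i % M) ⊎ t ≡ w (prev i)
        neighbours-on-cycle {zero}  _   r = neighbours-of-v r
        neighbours-on-cycle {suc i} i<M r with neighbours-of-w i r
        ... | inj₁ t≡wi   = inj₂ t≡wi
        ... | inj₂ t≡wi+2 = inj₁ (trans t≡wi+2 (sym (w-suc% i<M)))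

        f : Fin M → Fin n
        f i = w (F.toℕ i)

        f-injective : ∀ i j → f i ≡ f j → i ≡ j
        f-injective i j fi≡fj = F.toℕ-injective (w-injective (F.toℕ<n i) (F.toℕ<n j) fi≡fj)

        reach : ∀ k → Star R v (w k)
        reach zero    = ε
        reach (suc k) = reach k ◅◅ (step k ◅ ε)

        index : ∀ {k t} → k < M → t ≡ w k → ∃[ j ] f j ≡ t
        index k<M t≡wk = F.fromℕ< k<M , trans (cong w (F.toℕ-fromℕ< k<M)) (sym t≡wk)

        closed : ∀ i {t} → R (f i) t → ∃[ j ] f j ≡ t
        closed i r with neighbours-on-cycle (F.toℕ<n i) r
        ... | inj₁ e = index (m%n<n (suc (F.toℕ i)) M) e
        ... | inj₂ e = index (prev<M (F.toℕ<n i)) e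

        iso : ∀ i j → R (f i) (f j) ⇔ CycleC M i j
        iso i j = mk⇔ to from
          where
          i<M = F.toℕ<n i
          j<M = F.toℕ<n j
          to : R (f i) (f j) → CycleC M i j
          to r with neighbours-on-cycle i<M r
          ... | inj₁ e = inj₁ (w-injective j<M (m%n<n (suc (F.toℕ i)) M) e)
          ... | inj₂ e = inj₂ (trans (sym (suc-prev i<M)) (cong (λ k → suc k % M) (sym (w-injective j<M (prev<M i<M) e))))
          from : CycleC M i j → R (f i) (f j)
          from (inj₁ e) = subst (R (f i)) (trans (sym (w-suc% i<M)) (cong w (sym e))) (step (F.toℕ i))
          from (inj₂ e) = R-sym (subst (R (f j)) (trans (sym (w-suc% j<M)) (cong w (sym e))) (step (F.toℕ j)))

        cycle : ∃[ k ] (3 ≤ k × ComponentIso R v k (CycleC k))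
        cycle = M , 3≤M , f , f-injective , reach ∘ F.toℕ , image-closed f closed (0F , refl) , iso

    cycle-components : DisjointUnionOfCycles R
    cycle-components v (_ , v~a) with Walk.first-return v~a
    ... | zero  , (() , _) , _
    ... | suc m , (_ , returns) , first = Walk.FirstReturn.cycle v~a returns first

-- Edge orbits of a graph

module Automorphisms {n : ℕ} (G : SimpleGraph n) where

  Adj? : ∀ x y → Dec (Adj G x y)
  Adj? x y = adj G x y Bool.≟ true

  Adj-sym : ∀ {x y} → Adj G x y → Adj G y x
  Adj-sym {x} {y} = trans (SimpleGraph.sym G y x)

  Adj-irr : ∀ {x} → ¬ Adj G x x
  Adj-irr {x} x~x = case trans (sym x~x) (irrfl G x) of λ ()

  degree≡∑ : ∀ x → degree G x ≡ ∑[ y < n ] 𝟙 (Adj? x y)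
  degree≡∑ x = trans (length-filter-tabulate (T? ∘ adj G x) (λ y → y))
                     (sum-cong-≗ {n} λ y → 𝟙-cong Bool.T-≡ (T? (adj G x y)) (Adj? x y))

  IsAut? : (σ : Permutation′ n) → Dec (IsAut G σ)
  IsAut? σ = F.all? λ x → F.all? λ y → adj G (σ ⟨$⟩ʳ x) (σ ⟨$⟩ʳ y) Bool.≟ adj G x y

  IsAut-id : IsAut G Perm.id
  IsAut-id x y = refl

  IsAut-∘ : ∀ {σ τ} → IsAut G σ → IsAut G τ → IsAut G (σ Perm.∘ₚ τ)
  IsAut-∘ {σ} aut-σ aut-τ x y = trans (aut-τ (σ ⟨$⟩ʳ x) (σ ⟨$⟩ʳ y)) (aut-σ x y)

  IsAut-flip : ∀ {σ} → IsAut G σ → IsAut G (Perm.flip σ)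
  IsAut-flip {σ} aut-σ x y =
    trans (sym (aut-σ (σ ⟨$⟩ˡ x) (σ ⟨$⟩ˡ y))) (cong₂ (adj G) (Perm.inverseʳ σ) (Perm.inverseʳ σ))

  IsAut-resp : ∀ {σ τ} → τ ≈ σ → IsAut G σ → IsAut G τ
  IsAut-resp τ≈σ aut-σ x y = trans (cong₂ (adj G) (τ≈σ x) (τ≈σ y)) (aut-σ x y)

  MapsEdge : Fin n → Fin n → Fin n → Fin n → Permutation′ n → Set
  MapsEdge u v x y σ = (σ ⟨$⟩ʳ u ≡ x × σ ⟨$⟩ʳ v ≡ y) ⊎ (σ ⟨$⟩ʳ u ≡ y × σ ⟨$⟩ʳ v ≡ x)

  MapsEdge? : ∀ u v x y σ → Dec (MapsEdge u v x y σ)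
  MapsEdge? u v x y σ =
    ((σ ⟨$⟩ʳ u ≟ x) ×-dec (σ ⟨$⟩ʳ v ≟ y)) ⊎-dec ((σ ⟨$⟩ʳ u ≟ y) ×-dec (σ ⟨$⟩ʳ v ≟ x))

  MapsEdge-resp : ∀ {u v x y σ τ} → τ ≈ σ → MapsEdge u v x y σ → MapsEdge u v x y τ
  MapsEdge-resp {u} {v} τ≈σ (inj₁ (p , q)) = inj₁ (trans (τ≈σ u) p , trans (τ≈σ v) q)
  MapsEdge-resp {u} {v} τ≈σ (inj₂ (p , q)) = inj₂ (trans (τ≈σ u) p , trans (τ≈σ v) q)

  InOrb? : ∀ u v x y → Dec (InOrb G u v x y)
  InOrb? u v x y =
    map′ satisfied listed (any? (λ σ → IsAut? σ ×-dec MapsEdge? u v x y σ) (allPermutations n))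
    where
    listed : InOrb G u v x y → Any (λ σ → IsAut G σ × MapsEdge u v x y σ) (allPermutations n)
    listed (σ , aut-σ , maps) with ∈-allPermutations n σ
    ... | τ , τ∈ , τ≈σ = lose τ∈ (IsAut-resp {σ} {τ} τ≈σ aut-σ , MapsEdge-resp {σ = σ} {τ} τ≈σ maps)

  InOrb-refl : ∀ {u v} → InOrb G u v u v
  InOrb-refl = Perm.id , IsAut-id , inj₁ (refl , refl)

  InOrb-sym : ∀ {u v x y} → InOrb G u v x y → InOrb G u v y x
  InOrb-sym (σ , aut-σ , maps) = σ , aut-σ , swap maps

  InOrb-map : ∀ {u v x y} τ → IsAut G τ → InOrb G u v x y → InOrb G u v (τ ⟨$⟩ʳ x) (τ ⟨$⟩ʳ y)
  InOrb-map τ aut-τ (σ , aut-σ , maps) =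
    σ Perm.∘ₚ τ , IsAut-∘ {σ} {τ} aut-σ aut-τ , Sum.map apply apply maps
    where
    apply : ∀ {a b c d} → a ≡ b × c ≡ d → τ ⟨$⟩ʳ a ≡ τ ⟨$⟩ʳ b × τ ⟨$⟩ʳ c ≡ τ ⟨$⟩ʳ d
    apply = Product.map (cong (τ ⟨$⟩ʳ_)) (cong (τ ⟨$⟩ʳ_))

  InOrb-trans : ∀ {u v x y a b} → InOrb G u v x y → InOrb G x y a b → InOrb G u v a b
  InOrb-trans uv~xy (τ , aut-τ , inj₁ (refl , refl)) = InOrb-map τ aut-τ uv~xy
  InOrb-trans uv~xy (τ , aut-τ , inj₂ (refl , refl)) = InOrb-sym (InOrb-map τ aut-τ uv~xy)

  InOrb-flip : ∀ {u v x y} → InOrb G u v x y → InOrb G x y u v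
  InOrb-flip (σ , aut-σ , inj₁ (refl , refl)) =
    Perm.flip σ , IsAut-flip {σ} aut-σ , inj₁ (Perm.inverseˡ σ , Perm.inverseˡ σ)
  InOrb-flip (σ , aut-σ , inj₂ (refl , refl)) =
    Perm.flip σ , IsAut-flip {σ} aut-σ , inj₂ (Perm.inverseˡ σ , Perm.inverseˡ σ)

  InOrb-Adj : ∀ {u v x y} → Adj G u v → InOrb G u v x y → Adj G x y
  InOrb-Adj {u} {v} u~v (σ , aut-σ , inj₁ (refl , refl)) = trans (aut-σ u v) u~v
  InOrb-Adj {u} {v} u~v (σ , aut-σ , inj₂ (refl , refl)) = Adj-sym (trans (aut-σ u v) u~v)

  InOrb-endpoints : (f : Fin n → ℕ) → (∀ σ → IsAut G σ → ∀ x → f (σ ⟨$⟩ʳ x) ≡ f x) →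
    ∀ {u v x y} → InOrb G u v x y → (f x ≡ f u × f y ≡ f v) ⊎ (f x ≡ f v × f y ≡ f u)
  InOrb-endpoints f f-inv {u} {v} (σ , aut-σ , inj₁ (refl , refl)) = inj₁ (f-inv σ aut-σ u , f-inv σ aut-σ v)
  InOrb-endpoints f f-inv {u} {v} (σ , aut-σ , inj₂ (refl , refl)) = inj₂ (f-inv σ aut-σ v , f-inv σ aut-σ u)

module EdgeOrbit {n : ℕ} (G : SimpleGraph n) {u v : Fin n} (u~v : Adj G u v) where
  open Automorphisms G
  open SimpleRelation (InOrb G u v) (InOrb? u v) InOrb-sym (Adj-irr ∘ InOrb-Adj u~v) public

  InOrb-unmap : ∀ σ → IsAut G σ → ∀ {x y} → InOrb G u v (σ ⟨$⟩ʳ x) (σ ⟨$⟩ʳ y) → InOrb G u v x y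
  InOrb-unmap σ aut-σ uv~σxσy = subst₂ (InOrb G u v) (Perm.inverseˡ σ) (Perm.inverseˡ σ)
    (InOrb-map (Perm.flip σ) (IsAut-flip {σ} aut-σ) uv~σxσy)

  deg-invariant : ∀ σ → IsAut G σ → ∀ x → deg (σ ⟨$⟩ʳ x) ≡ deg x
  deg-invariant σ aut-σ x = begin
    deg (σ ⟨$⟩ʳ x)                                   ≡⟨ deg≡∑ (σ ⟨$⟩ʳ x) ⟩
    ∑[ y < n ] 𝟙 (InOrb? u v (σ ⟨$⟩ʳ x) y)           ≡⟨ ∑-permute _ σ ⟩
    ∑[ y < n ] 𝟙 (InOrb? u v (σ ⟨$⟩ʳ x) (σ ⟨$⟩ʳ y)) ≡⟨ sum-cong-≗ {n} (λ y → 𝟙-cong σ-invariant _ _) ⟩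
    ∑[ y < n ] 𝟙 (InOrb? u v x y)                     ≡⟨ deg≡∑ x ⟨
    deg x                                             ∎
    where
    open ≡-Reasoning
    σ-invariant : ∀ {y} → InOrb G u v (σ ⟨$⟩ʳ x) (σ ⟨$⟩ʳ y) ⇔ InOrb G u v x y
    σ-invariant = mk⇔ (InOrb-unmap σ aut-σ) (InOrb-map σ aut-σ)

  orbitSize : OrbitSize G u v edgeCount
  orbitSize = edgeList , uniq , length≡edgeCount edgeList uniq ∈-edgeList , ∈-edgeList
    where
    pairs : List (Fin n × Fin n)
    pairs = cartesianProduct (allFin n) (allFin n)
    edgeList : List (Fin n × Fin n)
    edgeList = filter (uncurry Edge?) pairs
    uniq : Unique edgeList
    uniq = filter⁺ (uncurry Edge?) (cartesianProduct⁺ (allFin⁺ n) (allFin⁺ n))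
    ∈-edgeList : ∀ x y → (x , y) ∈ edgeList ⇔ Edge x y
    ∈-edgeList x y = mk⇔ (proj₂ ∘ ∈-filter⁻ (uncurry Edge?) {xs = pairs})
                         (∈-filter⁺ (uncurry Edge?) (∈-cartesianProduct⁺ (∈-allFin x) (∈-allFin y)))


-- Comparing orbit sizes by double counting

module OrbitComparison {n : ℕ} (G : SimpleGraph n) (cubic : Cubic G) {u v : Fin n} (u~v : Adj G u v) where
  open Automorphisms G
  module H = EdgeOrbit G u~v

  Two : Fin n → Set
  Two x = H.deg x ≡ 2

  two? : ∀ x → Dec (Two x)
  two? x = H.deg x ℕ.≟ 2

  weight : Fin n → Fin n → ℕ
  weight x y = 𝟙 (two? x) + 𝟙 (two? y)

  twos : ℕ
  twos = ∑[ x < n ] 𝟙 (two? x)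

  weight-orbit : ∀ {a b x y} → InOrb G a b x y → weight x y ≡ weight a b
  weight-orbit {a} {b} ab~xy with InOrb-endpoints (𝟙 ∘ two?) 𝟙-two-invariant ab~xy
    where
    𝟙-two-invariant : ∀ σ → IsAut G σ → ∀ x → 𝟙 (two? (σ ⟨$⟩ʳ x)) ≡ 𝟙 (two? x)
    𝟙-two-invariant σ aut-σ x =
      𝟙-cong (mk⇔ (trans (sym (H.deg-invariant σ aut-σ x))) (trans (H.deg-invariant σ aut-σ x))) _ _
  ... | inj₁ (p , q) = cong₂ _+_ p q
  ... | inj₂ (p , q) = trans (cong₂ _+_ p q) (+-comm (𝟙 (two? b)) (𝟙 (two? a)))

  incidences : ∀ {a b} (a~b : Adj G a b) →
    weight a b * EdgeOrbit.edgeCount G a~b ≡ ∑[ x < n ] (𝟙 (two? x) * EdgeOrbit.deg G a~b x)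
  incidences {a} {b} a~b = EdgeOrbit.handshake G a~b (𝟙 ∘ two?) (weight a b) weight-orbit

  H-incidences : ∑[ x < n ] (𝟙 (two? x) * H.deg x) ≡ 2 * twos
  H-incidences = trans (sum-cong-≗ {n} λ x → at x (two? x)) (sym (*-distribˡ-sum {n} 2 _))
    where
    at : ∀ x (d : Dec (Two x)) → 𝟙 d * H.deg x ≡ 2 * 𝟙 d
    at x (yes two) = trans (+-identityʳ (H.deg x)) two
    at x (no _)    = refl

  module _ {w z : Fin n} (w~z : Adj G w z) (w≁z : ¬ InOrb G u v w z) where
    module Wz = EdgeOrbit G w~z

    Wz-deg≤1 : ∀ {x} → Two x → Wz.deg x ≤ 1
    Wz-deg≤1 {x} two = +-cancelʳ-≤ 2 (Wz.deg x) 1 (begin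
      Wz.deg x + 2
        ≡⟨ cong₂ _+_ (Wz.deg≡∑ x) (trans (sym two) (H.deg≡∑ x)) ⟩
      ∑[ y < n ] 𝟙 (InOrb? w z x y) + ∑[ y < n ] 𝟙 (InOrb? u v x y)
        ≡⟨ ∑-distrib-+ {n} _ _ ⟨
      ∑[ y < n ] (𝟙 (InOrb? w z x y) + 𝟙 (InOrb? u v x y))
        ≤⟨ ∑-mono-≤ (λ y → 𝟙-+-≤ disjoint (InOrb-Adj w~z) (InOrb-Adj u~v)
                                 (InOrb? w z x y) (InOrb? u v x y) (Adj? x y)) ⟩
      ∑[ y < n ] 𝟙 (Adj? x y)
        ≡⟨ trans (sym (degree≡∑ x)) (cubic x) ⟩
      3 ∎)
      where
      open ≤-Reasoning
      disjoint : ∀ {y} → ¬ (InOrb G w z x y × InOrb G u v x y)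
      disjoint (wz~xy , uv~xy) = w≁z (InOrb-trans uv~xy (InOrb-flip wz~xy))

    Wz-incidences : ∑[ x < n ] (𝟙 (two? x) * Wz.deg x) ≤ twos
    Wz-incidences = ∑-mono-≤ λ x → at x (two? x)
      where
      at : ∀ x (d : Dec (Two x)) → 𝟙 d * Wz.deg x ≤ 𝟙 d
      at x (yes two) = ≤-trans (≤-reflexive (+-identityʳ (Wz.deg x))) (Wz-deg≤1 two)
      at x (no _)    = z≤n

    smaller-orbit : Two w → 1 ≤ weight u v → weight u v ≤ weight w z → Wz.edgeCount < H.edgeCount
    smaller-orbit two 1≤c c≤c′ = *-cancelˡ-< (weight u v) Wz.edgeCount H.edgeCount (begin-strict
      weight u v * Wz.edgeCount            ≤⟨ *-monoˡ-≤ Wz.edgeCount c≤c′ ⟩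
      weight w z * Wz.edgeCount            ≡⟨ incidences w~z ⟩
      ∑[ x < n ] (𝟙 (two? x) * Wz.deg x)   ≤⟨ Wz-incidences ⟩
      twos                                 <⟨ m<n+m twos (∑-𝟙-pos two? two) ⟩
      twos + twos                          ≡⟨ cong (twos +_) (+-identityʳ twos) ⟨
      2 * twos                             ≡⟨ H-incidences ⟨
      ∑[ x < n ] (𝟙 (two? x) * H.deg x)    ≡⟨ incidences u~v ⟨
      weight u v * H.edgeCount             ∎)
      where open ≤-Reasoning

module Minimality {n : ℕ} (G : SimpleGraph n) (cubic : Cubic G) {u v : Fin n} (u~v : Adj G u v)
  (minimal : MinimalOrbit G u v) where
  open Automorphisms G
  open OrbitComparison G cubic u~v

  no-smaller-orbit : ∀ {w z} (w~z : Adj G w z) → ¬ EdgeOrbit.edgeCount G w~z < H.edgeCount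
  no-smaller-orbit {w} {z} w~z smaller =
    <⇒≱ smaller (minimal w z w~z _ _ H.orbitSize (EdgeOrbit.orbitSize G w~z))

  degree≡3 : ∀ x → ∑[ y < n ] 𝟙 (Adj? x y) ≡ 3
  degree≡3 x = trans (sym (degree≡∑ x)) (cubic x)

  saturated : ∀ {x y} → H.deg x ≡ 3 → Adj G x y → InOrb G u v x y
  saturated {x} d≡3 = ∑-𝟙-saturated (InOrb? u v x) (Adj? x) (InOrb-Adj u~v)
    (≤-reflexive (trans (degree≡3 x) (trans (sym d≡3) (H.deg≡∑ x))))

  unsaturated : ∀ {x} → H.deg x ≡ 2 → ∃[ z ] (Adj G x z × ¬ InOrb G u v x z)
  unsaturated {x} d≡2 = ∑-𝟙-unsaturated (InOrb? u v x) (Adj? x)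
    (subst₂ _<_ (trans (sym d≡2) (H.deg≡∑ x)) (sym (degree≡3 x)) ≤-refl)

  endpoint-degrees : ∀ {a b} → H.deg u ≡ a → H.deg v ≡ b → ∀ {x y} → InOrb G u v x y →
    (H.deg x ≡ a × H.deg y ≡ b) ⊎ (H.deg x ≡ b × H.deg y ≡ a)
  endpoint-degrees du dv uv~xy with InOrb-endpoints H.deg H.deg-invariant uv~xy
  ... | inj₁ (p , q) = inj₁ (trans p du , trans q dv)
  ... | inj₂ (p , q) = inj₂ (trans p dv , trans q du)

  same-endpoint-degrees : ∀ {a} → H.deg u ≡ a → H.deg v ≡ a → ∀ {x y} → InOrb G u v x y → H.deg x ≡ a
  same-endpoint-degrees du dv uv~xy = [ proj₁ , proj₁ ]′ (endpoint-degrees du dv uv~xy)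

  deg-1-or-3 : ∀ {x y} → InOrb G u v x y → ¬ Two x → H.deg x ≡ 1 ⊎ H.deg x ≡ 3
  deg-1-or-3 {x} uv~xy ¬two = cases (H.deg x) 1≤deg deg≤3 ¬two
    where
    open ≤-Reasoning
    1≤deg : 1 ≤ H.deg x
    1≤deg = begin
      1                               ≤⟨ ∑-𝟙-pos (InOrb? u v x) uv~xy ⟩
      ∑[ y < n ] 𝟙 (InOrb? u v x y)  ≡⟨ H.deg≡∑ x ⟨
      H.deg x                         ∎
    deg≤3 : H.deg x ≤ 3
    deg≤3 = begin
      H.deg x                         ≡⟨ H.deg≡∑ x ⟩
      ∑[ y < n ] 𝟙 (InOrb? u v x y)  ≤⟨ ∑-mono-≤ (λ y → 𝟙-mono (InOrb-Adj u~v) (InOrb? u v x y) (Adj? x y)) ⟩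
      ∑[ y < n ] 𝟙 (Adj? x y)        ≡⟨ degree≡3 x ⟩
      3                               ∎
    cases : ∀ d → 1 ≤ d → d ≤ 3 → d ≢ 2 → d ≡ 1 ⊎ d ≡ 3
    cases 1 _ _ _   = inj₁ refl
    cases 2 _ _ d≢2 = ⊥-elim (d≢2 refl)
    cases 3 _ _ _   = inj₂ refl
    cases (suc (suc (suc (suc _)))) _ (s≤s (s≤s (s≤s ()))) _

  edge-transitive : Connected G → H.deg u ≡ 3 → H.deg v ≡ 3 → EdgeTransitiveOrb G u v
  edge-transitive connected du dv x y = saturated (spread (connected u x) du)
    where
    spread : ∀ {p q} → Star (Adj G) p q → H.deg p ≡ 3 → H.deg q ≡ 3
    spread ε             dp = dp
    spread (p~p′ ◅ rest) dp = spread rest (same-endpoint-degrees du dv (InOrb-sym (saturated dp p~p′)))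

  weight-one-impossible : weight u v ≡ 1 → ∀ {w} → ¬ Two w
  weight-one-impossible weight≡1 {w} two with unsaturated two
  ... | z , w~z , w≁z = no-smaller-orbit w~z (smaller-orbit w~z w≁z two (≤-reflexive (sym weight≡1)) c≤c′)
    where
    c≤c′ : weight u v ≤ weight w z
    c≤c′ = subst (_≤ weight w z) (sym weight≡1) (≤-trans (≤-reflexive (sym (𝟙-yes two (two? w)))) (m≤m+n _ _))

  weight-two : ∀ {x y} → Two x → Two y → weight x y ≡ 2
  weight-two {x} {y} tx ty = cong₂ _+_ (𝟙-yes tx (two? x)) (𝟙-yes ty (two? y))

  components-far : Two u → Two v → ComponentsFar G (InOrb G u v)
  components-far tu tv x y (_ , uv~xx′) (_ , uv~yy′) x~y with InOrb? u v x y
  ... | yes uv~xy = uv~xy ◅ ε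
  ... | no x≁y    = ⊥-elim (no-smaller-orbit x~y (smaller-orbit x~y x≁y tx 1≤c c≤c′))
    where
    tx = same-endpoint-degrees tu tv uv~xx′
    ty = same-endpoint-degrees tu tv uv~yy′
    1≤c : 1 ≤ weight u v
    1≤c = subst (1 ≤_) (sym (weight-two tu tv)) (s≤s z≤n)
    c≤c′ : weight u v ≤ weight x y
    c≤c′ = ≤-reflexive (trans (weight-two tu tv) (sym (weight-two tx ty)))

  classification : Connected G →
    EdgeTransitiveOrb G u v
    ⊎ DisjointUnionOf (InOrb G u v) 4 StarK13
    ⊎ DisjointUnionOf (InOrb G u v) 2 EdgeK2
    ⊎ (DisjointUnionOfCycles (InOrb G u v) × ComponentsFar G (InOrb G u v))
  classification connected with two? u | two? v
  ... | yes tu | yes tv =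
    inj₂ (inj₂ (inj₂ (H.TwoRegular.cycle-components (same-endpoint-degrees tu tv) , components-far tu tv)))
  ... | yes tu | no ¬tv = ⊥-elim (weight-one-impossible (cong₂ _+_ (𝟙-yes tu (two? u)) (𝟙-no ¬tv (two? v))) tu)
  ... | no ¬tu | yes tv = ⊥-elim (weight-one-impossible (cong₂ _+_ (𝟙-no ¬tu (two? u)) (𝟙-yes tv (two? v))) tv)
  ... | no ¬tu | no ¬tv with deg-1-or-3 InOrb-refl ¬tu | deg-1-or-3 (InOrb-sym InOrb-refl) ¬tv
  ...   | inj₁ du | inj₁ dv = inj₂ (inj₂ (inj₁ (H.edge-components (same-endpoint-degrees du dv))))
  ...   | inj₁ du | inj₂ dv = inj₂ (inj₁ (H.star-components (swap ∘ endpoint-degrees du dv)))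
  ...   | inj₂ du | inj₁ dv = inj₂ (inj₁ (H.star-components (endpoint-degrees du dv)))
  ...   | inj₂ du | inj₂ dv = inj₁ (edge-transitive connected du dv)

lemma3p1 : {n : ℕ} (G : SimpleGraph n) → Connected G → Cubic G →
    (u v : Fin n) → Adj G u v → MinimalOrbit G u v →
    EdgeTransitiveOrb G u v
    ⊎ DisjointUnionOf (InOrb G u v) 4 StarK13
    ⊎ DisjointUnionOf (InOrb G u v) 2 EdgeK2
    ⊎ (DisjointUnionOfCycles (InOrb G u v) × ComponentsFar G (InOrb G u v))
lemma3p1 G connected cubic u v u~v minimal = Minimality.classification G cubic u~v minimal connected
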